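{- Let $m\geq 2$ be an integer. The maps $$\phi' : x_1\cdots x_k\in\mathcal H(m)\mapsto x_1\cdots x_k\,0\in\mathcal H(2m),\qquad \phi'' : x_1\cdots x_k\in\mathcal H(m-1)\mapsto x_1\cdots x_k\,2\in\mathcal H(2m)$$ induce graph monomorphisms (injective vertex maps sending arcs to arcs of the same colour) from $A(m)$ and from $A(m-1)$, respectively, to $A(2m)$. Moreover $\phi'(\mathcal H(m))\cup\phi''(\mathcal H(m-1))=\mathcal H(2m)$.
   Context: A hyperbinary expansion of a positive integer $n$ is a word $x_1\cdots x_k$ over the alphabet $\{0,1,2\}$ with $x_1\neq 0$ and $n=\sum_{i=1}^k x_i2^{k-i}$; $\mathcal H(n)$ denotes the set of hyperbinary expansions of $n$. Words are regarded up to leading zeros. Single-step reductions are: (I) $2\vec y \to 1\,0\,\vec y$; (II) $\vec x\,0\,2\,\vec y\to \vec x\,1\,0\,\vec y$; (III) $\vec x\,1\,2\,\vec y \twoheadrightarrow \vec x\,2\,0\,\vec y$, for words $\vec x,\vec y$ over $\{0,1,2\}$. If $\vec u$ is transformed into $\vec v$ by one single-step reduction, $\vec v$ is a child of $\vec u$. $A(n)$ is the directed graph with vertex set $\mathcal H(n)$ and an arc from $\vec u$ to $\vec v$ iff $\vec v$ is a child of $\vec u$; arcs from reductions of type I or II are coloured "$\to$", those of type III are coloured "$\twoheadrightarrow$". -}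

module Defs where

open import Data.Nat using (ℕ; zero; suc; _+_; _*_)
open import Data.List using (List; []; _∷_; _++_; foldl)
open import Data.Product using (_×_)
open import Data.Empty using (⊥)
open import Relation.Binary.PropositionalEquality using (_≡_)
open import Relation.Nullary using (¬_)

data Digit : Set where
  d0 d1 d2 : Digit

digitVal : Digit → ℕ
digitVal d0 = 0
digitVal d1 = 1
digitVal d2 = 2

val : List Digit → ℕ
val = foldl (λ acc d → 2 * acc + digitVal d) 0

LeadingNonzero : List Digit → Set
LeadingNonzero []      = ⊥
LeadingNonzero (d ∷ _) = ¬ (d ≡ d0)

Hyp : ℕ → List Digit → Set
Hyp n w = LeadingNonzero w × val w ≡ n

-- arc colours: "→" (types I, II) and "↠" (type III)
data Colour : Set where
  single double : Colour

data Step : Colour → List Digit → List Digit → Set where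
  typeI   : ∀ y   → Step single (d2 ∷ y) (d1 ∷ d0 ∷ y)
  typeII  : ∀ x y → Step single (x ++ d0 ∷ d2 ∷ y) (x ++ d1 ∷ d0 ∷ y)
  typeIII : ∀ x y → Step double (x ++ d1 ∷ d2 ∷ y) (x ++ d2 ∷ d0 ∷ y)

Arc : ℕ → Colour → List Digit → List Digit → Set
Arc n c u v = Hyp n u × Hyp n v × Step c u v

record GraphMono (n n' : ℕ) (f : List Digit → List Digit) : Set where
  field
    maps      : ∀ u → Hyp n u → Hyp n' (f u)
    injective : ∀ u v → Hyp n u → Hyp n v → f u ≡ f v → u ≡ v
    arcs      : ∀ c u v → Arc n c u v → Arc n' c (f u) (f v)

φ′ : List Digit → List Digit
φ′ w = w ++ d0 ∷ []

φ″ : List Digit → List Digit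
φ″ w = w ++ d2 ∷ []

-- Appending a digit d to a word multiplies its value by 2 and adds d, keeps the leading
-- digit, and commutes with every reduction (a reduction rewrites a factor of the word, and
-- that factor is still there after appending).  Conversely the last digit of an expansion of
-- the even number 2m cannot be 1, and removing it leaves an expansion of m (last digit 0)
-- or of m-1 (last digit 2); m ≥ 2 guarantees that what remains is nonempty.
module Submission where

open import Defs
open import Data.Nat using (ℕ; zero; suc; _+_; _*_; _∸_; _≤_; s≤s; z≤n)
open import Data.Nat.Properties
  using (*-cancelˡ-≡; *-suc; +-comm; +-identityʳ; even≢odd; <⇒≢; <-trans)
open import Data.List using ([]; _∷_; _∷ʳ_; InitLast; _∷ʳ′_; initLast)
open import Data.List.Properties using (foldl-∷ʳ; ∷ʳ-injectiveˡ; ++-assoc)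
open import Data.Product using (_×_; ∃-syntax; _,_)
open import Data.Sum using (_⊎_; inj₁; inj₂)
open import Data.Empty using (⊥-elim)
open import Relation.Binary.PropositionalEquality using (_≡_; _≢_; refl; sym; trans; cong)

val-∷ʳ : ∀ w d → val (w ∷ʳ d) ≡ 2 * val w + digitVal d
val-∷ʳ w d = foldl-∷ʳ (λ acc e → 2 * acc + digitVal e) 0 d w

LeadingNonzero-∷ʳ : ∀ {w} d → LeadingNonzero w → LeadingNonzero (w ∷ʳ d)
LeadingNonzero-∷ʳ {_ ∷ _} d nz = nz

LeadingNonzero-∷ʳ⁻ : ∀ w d → val w ≢ 0 → LeadingNonzero (w ∷ʳ d) → LeadingNonzero w
LeadingNonzero-∷ʳ⁻ []      d val≢0 _  = ⊥-elim (val≢0 refl)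
LeadingNonzero-∷ʳ⁻ (_ ∷ _) d _     nz = nz

Step-∷ʳ : ∀ {c u v} d → Step c u v → Step c (u ∷ʳ d) (v ∷ʳ d)
Step-∷ʳ d (typeI y) = typeI (y ∷ʳ d)
Step-∷ʳ d (typeII x y)
  rewrite ++-assoc x (d0 ∷ d2 ∷ y) (d ∷ []) | ++-assoc x (d1 ∷ d0 ∷ y) (d ∷ [])
  = typeII x (y ∷ʳ d)
Step-∷ʳ d (typeIII x y)
  rewrite ++-assoc x (d1 ∷ d2 ∷ y) (d ∷ []) | ++-assoc x (d2 ∷ d0 ∷ y) (d ∷ [])
  = typeIII x (y ∷ʳ d)

Hyp-∷ʳ : ∀ {n n′ w} d → 2 * n + digitVal d ≡ n′ → Hyp n w → Hyp n′ (w ∷ʳ d)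
Hyp-∷ʳ {w = w} d n′≡ (nz , val≡n) =
  LeadingNonzero-∷ʳ d nz , trans (val-∷ʳ w d) (trans (cong (λ k → 2 * k + digitVal d) val≡n) n′≡)

∷ʳ-GraphMono : ∀ {n n′} d → 2 * n + digitVal d ≡ n′ → GraphMono n n′ (_∷ʳ d)
∷ʳ-GraphMono d n′≡ = record
  { maps      = λ u → Hyp-∷ʳ d n′≡
  ; injective = λ u v _ _ → ∷ʳ-injectiveˡ u v
  ; arcs      = λ c u v (hu , hv , step) → Hyp-∷ʳ d n′≡ hu , Hyp-∷ʳ d n′≡ hv , Step-∷ʳ d step
  }

double-suc : ∀ a → 2 * suc a ≡ 2 * a + 2
double-suc a = trans (*-suc 2 a) (+-comm 2 (2 * a))

double+digit≡double : ∀ a d m → 2 * a + digitVal d ≡ 2 * m →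
                      (d ≡ d0 × a ≡ m) ⊎ (d ≡ d2 × suc a ≡ m)
double+digit≡double a d0 m eq = inj₁ (refl , *-cancelˡ-≡ a m 2 (trans (sym (+-identityʳ _)) eq))
double+digit≡double a d1 m eq = ⊥-elim (even≢odd m a (sym (trans (+-comm 1 (2 * a)) eq)))
double+digit≡double a d2 m eq =
  inj₂ (refl , *-cancelˡ-≡ (suc a) m 2 (trans (double-suc a) eq))

Hyp-double⇒φ′⊎φ″ : ∀ {m} → 2 ≤ m → ∀ {w} → InitLast w → Hyp (2 * m) w →
                 (∃[ u ] (Hyp m u × w ≡ φ′ u)) ⊎ (∃[ u ] (Hyp (m ∸ 1) u × w ≡ φ″ u))
Hyp-double⇒φ′⊎φ″ 2≤m [] (() , _)
Hyp-double⇒φ′⊎φ″ {m} 2≤m (u ∷ʳ′ d) (nz , val≡2m)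
  with double+digit≡double (val u) d m (trans (sym (val-∷ʳ u d)) val≡2m)
... | inj₁ (refl , val≡m) =
  inj₁ (u , (LeadingNonzero-∷ʳ⁻ u d val≢0 nz , val≡m) , refl)
  where
  val≢0 : val u ≢ 0
  val≢0 val≡0 = <⇒≢ (<-trans (s≤s z≤n) 2≤m) (trans (sym val≡0) val≡m)
... | inj₂ (refl , 1+val≡m) =
  inj₂ (u , (LeadingNonzero-∷ʳ⁻ u d val≢0 nz , cong (_∸ 1) 1+val≡m) , refl)
  where
  val≢0 : val u ≢ 0
  val≢0 val≡0 = <⇒≢ 2≤m (trans (cong suc (sym val≡0)) 1+val≡m)

proposition3p4 : (m : ℕ) → 2 ≤ m →
      GraphMono m (2 * m) φ′
    × GraphMono (m ∸ 1) (2 * m) φ″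
    × (∀ w → Hyp (2 * m) w →
         (∃[ u ] (Hyp m u × w ≡ φ′ u)) ⊎ (∃[ u ] (Hyp (m ∸ 1) u × w ≡ φ″ u)))
proposition3p4 zero ()
proposition3p4 m@(suc m-1) 2≤m =
    ∷ʳ-GraphMono d0 (+-identityʳ (2 * m))
  , ∷ʳ-GraphMono d2 (sym (double-suc m-1))
  , λ w → Hyp-double⇒φ′⊎φ″ 2≤m (initLast w)
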